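{- Let $R$ be a proposition rewrite system and $A$ a closed proposition containing no predicate or function symbol appearing in $R$. If $R$ is terminating and confluent, then so is its $A$-translation $R^A$.
   Context: Propositions are first-order with connectives $\wedge,\vee,\Rightarrow,\top,\bot$ and quantifiers $\forall,\exists$. A proposition rewrite system is an orthogonal set of rules $P\to F$ with $P$ atomic and $FV(F)\subseteq FV(P)$. Writing $\neg_A X:=(X\Rightarrow A)\Rightarrow A$, the $A$-translation of a proposition is: $B^A=B$ for atomic $B$; $\top^A=\top$; $\bot^A=\bot$; $(B\circ C)^A=\neg_A B^A\circ\neg_A C^A$ for $\circ\in\{\Rightarrow,\wedge,\vee\}$; $(Qx B)^A=Qx\,\neg_A B^A$ for $Q\in\{\forall,\exists\}$. For $R=\{P_i\to F_i\}$, $R^A=\{P_i\to F_i^A\}$. -}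

module Defs where

open import Data.Nat using (ℕ; zero; suc; _+_; _≤_)
open import Data.Fin using (Fin; zero; suc; _≟_)
open import Data.Vec using (Vec; []; _∷_)
open import Data.Product using (Σ; ∃; _×_; _,_)
open import Data.Sum using (_⊎_)
open import Relation.Nullary using (¬_; yes; no)
open import Relation.Binary.PropositionalEquality using (_≡_; _≢_)
open import Relation.Binary.Construct.Closure.ReflexiveTransitive using (Star)
open import Induction.WellFounded using (WellFounded)

record Signature : Set₁ where
  field
    Fun       : Set
    Pred      : Set
    funArity  : Fun → ℕ
    predArity : Pred → ℕ

module FOL (S : Signature) where
  open Signature S

  -- Well-scoped de Bruijn syntax: Term n / Prop n have at most n free variables.
  data Term (n : ℕ) : Set where
    var : Fin n → Term n
    fun : (f : Fun) → Vec (Term n) (funArity f) → Term n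

  infixr 5 _⇒_
  infixr 6 _∨_
  infixr 7 _∧_
  data Prop (n : ℕ) : Set where
    atom    : (p : Pred) → Vec (Term n) (predArity p) → Prop n
    ⊤′ ⊥′   : Prop n
    _⇒_ _∧_ _∨_ : Prop n → Prop n → Prop n
    ∀′ ∃′   : Prop (suc n) → Prop n

  Ren : ℕ → ℕ → Set
  Ren m n = Fin m → Fin n

  Subst : ℕ → ℕ → Set
  Subst m n = Fin m → Term n

  mutual
    renT : ∀ {m n} → Ren m n → Term m → Term n
    renT ρ (var x)    = var (ρ x)
    renT ρ (fun f ts) = fun f (renTs ρ ts)

    renTs : ∀ {m n k} → Ren m n → Vec (Term m) k → Vec (Term n) k
    renTs ρ []       = []
    renTs ρ (t ∷ ts) = renT ρ t ∷ renTs ρ ts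

  liftR : ∀ {m n} → Ren m n → Ren (suc m) (suc n)
  liftR ρ zero    = zero
  liftR ρ (suc x) = suc (ρ x)

  renP : ∀ {m n} → Ren m n → Prop m → Prop n
  renP ρ (atom p ts) = atom p (renTs ρ ts)
  renP ρ ⊤′          = ⊤′
  renP ρ ⊥′          = ⊥′
  renP ρ (φ ⇒ ψ)     = renP ρ φ ⇒ renP ρ ψ
  renP ρ (φ ∧ ψ)     = renP ρ φ ∧ renP ρ ψ
  renP ρ (φ ∨ ψ)     = renP ρ φ ∨ renP ρ ψ
  renP ρ (∀′ φ)      = ∀′ (renP (liftR ρ) φ)
  renP ρ (∃′ φ)      = ∃′ (renP (liftR ρ) φ)

  mutual
    substT : ∀ {m n} → Subst m n → Term m → Term n
    substT σ (var x)    = σ x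
    substT σ (fun f ts) = fun f (substTs σ ts)

    substTs : ∀ {m n k} → Subst m n → Vec (Term m) k → Vec (Term n) k
    substTs σ []       = []
    substTs σ (t ∷ ts) = substT σ t ∷ substTs σ ts

  liftS : ∀ {m n} → Subst m n → Subst (suc m) (suc n)
  liftS σ zero    = var zero
  liftS σ (suc x) = renT suc (σ x)

  substP : ∀ {m n} → Subst m n → Prop m → Prop n
  substP σ (atom p ts) = atom p (substTs σ ts)
  substP σ ⊤′          = ⊤′
  substP σ ⊥′          = ⊥′
  substP σ (φ ⇒ ψ)     = substP σ φ ⇒ substP σ ψ
  substP σ (φ ∧ ψ)     = substP σ φ ∧ substP σ ψ
  substP σ (φ ∨ ψ)     = substP σ φ ∨ substP σ ψ
  substP σ (∀′ φ)      = ∀′ (substP (liftS σ) φ)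
  substP σ (∃′ φ)      = ∃′ (substP (liftS σ) φ)

  weaken₀ : ∀ {n} → Prop 0 → Prop n
  weaken₀ = renP (λ ())

  mutual
    data OccT {n} (x : Fin n) : Term n → Set where
      here  : OccT x (var x)
      inFun : ∀ {f ts} → OccTs x ts → OccT x (fun f ts)

    data OccTs {n} (x : Fin n) : ∀ {k} → Vec (Term n) k → Set where
      hd : ∀ {k t} {ts : Vec (Term n) k} → OccT x t → OccTs x (t ∷ ts)
      tl : ∀ {k t} {ts : Vec (Term n) k} → OccTs x ts → OccTs x (t ∷ ts)

  data OccP : ∀ {n} → Fin n → Prop n → Set where
    atom : ∀ {n x p ts} → OccTs {n} x ts → OccP x (atom p ts)
    ⇒l : ∀ {n x} {φ ψ : Prop n} → OccP x φ → OccP x (φ ⇒ ψ)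
    ⇒r : ∀ {n x} {φ ψ : Prop n} → OccP x ψ → OccP x (φ ⇒ ψ)
    ∧l : ∀ {n x} {φ ψ : Prop n} → OccP x φ → OccP x (φ ∧ ψ)
    ∧r : ∀ {n x} {φ ψ : Prop n} → OccP x ψ → OccP x (φ ∧ ψ)
    ∨l : ∀ {n x} {φ ψ : Prop n} → OccP x φ → OccP x (φ ∨ ψ)
    ∨r : ∀ {n x} {φ ψ : Prop n} → OccP x ψ → OccP x (φ ∨ ψ)
    ∀b : ∀ {n x} {φ : Prop (suc n)} → OccP (suc x) φ → OccP x (∀′ φ)
    ∃b : ∀ {n x} {φ : Prop (suc n)} → OccP (suc x) φ → OccP x (∃′ φ)

  mutual
    countT : ∀ {n} → Fin n → Term n → ℕ
    countT x (var y) with x ≟ y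
    ... | yes _ = 1
    ... | no  _ = 0
    countT x (fun f ts) = countTs x ts

    countTs : ∀ {n k} → Fin n → Vec (Term n) k → ℕ
    countTs x []       = 0
    countTs x (t ∷ ts) = countT x t + countTs x ts

  mutual
    data FunInT (f : Fun) {n} : Term n → Set where
      here  : ∀ {ts} → FunInT f (fun f ts)
      inArg : ∀ {g ts} → FunInTs f ts → FunInT f (fun g ts)

    data FunInTs (f : Fun) {n} : ∀ {k} → Vec (Term n) k → Set where
      hd : ∀ {k t} {ts : Vec (Term n) k} → FunInT f t → FunInTs f (t ∷ ts)
      tl : ∀ {k t} {ts : Vec (Term n) k} → FunInTs f ts → FunInTs f (t ∷ ts)

  data FunInP (f : Fun) : ∀ {n} → Prop n → Set where
    atom : ∀ {n p ts} → FunInTs f {n} ts → FunInP f (atom p ts)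
    ⇒l : ∀ {n} {φ ψ : Prop n} → FunInP f φ → FunInP f (φ ⇒ ψ)
    ⇒r : ∀ {n} {φ ψ : Prop n} → FunInP f ψ → FunInP f (φ ⇒ ψ)
    ∧l : ∀ {n} {φ ψ : Prop n} → FunInP f φ → FunInP f (φ ∧ ψ)
    ∧r : ∀ {n} {φ ψ : Prop n} → FunInP f ψ → FunInP f (φ ∧ ψ)
    ∨l : ∀ {n} {φ ψ : Prop n} → FunInP f φ → FunInP f (φ ∨ ψ)
    ∨r : ∀ {n} {φ ψ : Prop n} → FunInP f ψ → FunInP f (φ ∨ ψ)
    ∀b : ∀ {n} {φ : Prop (suc n)} → FunInP f φ → FunInP f (∀′ φ)
    ∃b : ∀ {n} {φ : Prop (suc n)} → FunInP f φ → FunInP f (∃′ φ)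

  data PredInP (p : Pred) : ∀ {n} → Prop n → Set where
    atom : ∀ {n} {ts : Vec (Term n) (predArity p)} → PredInP p (atom p ts)
    ⇒l : ∀ {n} {φ ψ : Prop n} → PredInP p φ → PredInP p (φ ⇒ ψ)
    ⇒r : ∀ {n} {φ ψ : Prop n} → PredInP p ψ → PredInP p (φ ⇒ ψ)
    ∧l : ∀ {n} {φ ψ : Prop n} → PredInP p φ → PredInP p (φ ∧ ψ)
    ∧r : ∀ {n} {φ ψ : Prop n} → PredInP p ψ → PredInP p (φ ∧ ψ)
    ∨l : ∀ {n} {φ ψ : Prop n} → PredInP p φ → PredInP p (φ ∨ ψ)
    ∨r : ∀ {n} {φ ψ : Prop n} → PredInP p ψ → PredInP p (φ ∨ ψ)
    ∀b : ∀ {n} {φ : Prop (suc n)} → PredInP p φ → PredInP p (∀′ φ)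
    ∃b : ∀ {n} {φ : Prop (suc n)} → PredInP p φ → PredInP p (∃′ φ)

  record Rule : Set where
    field
      nvars : ℕ
      pred  : Pred
      args  : Vec (Term nvars) (predArity pred)
      rhs   : Prop nvars

    lhs : Prop nvars
    lhs = atom pred args

  open Rule public

  record RewriteSystem : Set₁ where
    field
      Index : Set
      rule  : Index → Rule

  open RewriteSystem public

  FVCondition : Rule → Set
  FVCondition r = ∀ x → OccP x (rhs r) → OccP x (lhs r)

  LeftLinear : Rule → Set
  LeftLinear r = ∀ x → countTs x (args r) ≤ 1

  NonOverlapping : RewriteSystem → Set
  NonOverlapping R = ∀ i j → i ≢ j → ∀ {n} (σ : Subst (nvars (rule R i)) n)
    (τ : Subst (nvars (rule R j)) n) →
    substP σ (lhs (rule R i)) ≢ substP τ (lhs (rule R j))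

  Orthogonal : RewriteSystem → Set
  Orthogonal R = (∀ i → LeftLinear (rule R i)) × NonOverlapping R

  IsPropRewriteSystem : RewriteSystem → Set
  IsPropRewriteSystem R = (∀ i → FVCondition (rule R i)) × Orthogonal R

  data _⊢_⟶_ (R : RewriteSystem) : ∀ {n} → Prop n → Prop n → Set where
    root : ∀ {n} (i : Index R) (σ : Subst (nvars (rule R i)) n) →
           R ⊢ substP σ (lhs (rule R i)) ⟶ substP σ (rhs (rule R i))
    ⇒l : ∀ {n} {φ φ′ ψ : Prop n} → R ⊢ φ ⟶ φ′ → R ⊢ (φ ⇒ ψ) ⟶ (φ′ ⇒ ψ)
    ⇒r : ∀ {n} {φ ψ ψ′ : Prop n} → R ⊢ ψ ⟶ ψ′ → R ⊢ (φ ⇒ ψ) ⟶ (φ ⇒ ψ′)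
    ∧l : ∀ {n} {φ φ′ ψ : Prop n} → R ⊢ φ ⟶ φ′ → R ⊢ (φ ∧ ψ) ⟶ (φ′ ∧ ψ)
    ∧r : ∀ {n} {φ ψ ψ′ : Prop n} → R ⊢ ψ ⟶ ψ′ → R ⊢ (φ ∧ ψ) ⟶ (φ ∧ ψ′)
    ∨l : ∀ {n} {φ φ′ ψ : Prop n} → R ⊢ φ ⟶ φ′ → R ⊢ (φ ∨ ψ) ⟶ (φ′ ∨ ψ)
    ∨r : ∀ {n} {φ ψ ψ′ : Prop n} → R ⊢ ψ ⟶ ψ′ → R ⊢ (φ ∨ ψ) ⟶ (φ ∨ ψ′)
    ∀b : ∀ {n} {φ φ′ : Prop (suc n)} → R ⊢ φ ⟶ φ′ → R ⊢ ∀′ φ ⟶ ∀′ φ′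
    ∃b : ∀ {n} {φ φ′ : Prop (suc n)} → R ⊢ φ ⟶ φ′ → R ⊢ ∃′ φ ⟶ ∃′ φ′

  _⊢_⟶*_ : (R : RewriteSystem) → ∀ {n} → Prop n → Prop n → Set
  R ⊢ φ ⟶* ψ = Star (R ⊢_⟶_) φ ψ

  Terminating : RewriteSystem → Set
  Terminating R = ∀ n → WellFounded (λ (ψ φ : Prop n) → R ⊢ φ ⟶ ψ)

  Confluent : RewriteSystem → Set
  Confluent R = ∀ {n} {φ ψ₁ ψ₂ : Prop n} → R ⊢ φ ⟶* ψ₁ → R ⊢ φ ⟶* ψ₂ →
    ∃ λ χ → (R ⊢ ψ₁ ⟶* χ) × (R ⊢ ψ₂ ⟶* χ)

  ¬[_]_ : ∀ {n} → Prop n → Prop n → Prop n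
  ¬[ A ] X = (X ⇒ A) ⇒ A

  _^_ : ∀ {n} → Prop n → Prop 0 → Prop n
  atom p ts ^ A = atom p ts
  ⊤′ ^ A        = ⊤′
  ⊥′ ^ A        = ⊥′
  (B ⇒ C) ^ A   = (¬[ weaken₀ A ] (B ^ A)) ⇒ (¬[ weaken₀ A ] (C ^ A))
  (B ∧ C) ^ A   = (¬[ weaken₀ A ] (B ^ A)) ∧ (¬[ weaken₀ A ] (C ^ A))
  (B ∨ C) ^ A   = (¬[ weaken₀ A ] (B ^ A)) ∨ (¬[ weaken₀ A ] (C ^ A))
  ∀′ B ^ A      = ∀′ (¬[ weaken₀ A ] (B ^ A))
  ∃′ B ^ A      = ∃′ (¬[ weaken₀ A ] (B ^ A))

  ruleA : Rule → Prop 0 → Rule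
  ruleA r A = record { nvars = nvars r ; pred = pred r ; args = args r ; rhs = rhs r ^ A }

  _^ᴿ_ : RewriteSystem → Prop 0 → RewriteSystem
  R ^ᴿ A = record { Index = Index R ; rule = λ i → ruleA (rule R i) A }

  PredInRule : Pred → Rule → Set
  PredInRule p r = PredInP p (lhs r) ⊎ PredInP p (rhs r)

  FunInRule : Fun → Rule → Set
  FunInRule f r = FunInP f (lhs r) ⊎ FunInP f (rhs r)

  FreshFor : RewriteSystem → Prop 0 → Set
  FreshFor R A =
    (∀ p → PredInP p A → ∀ i → ¬ PredInRule p (rule R i)) ×
    (∀ f → FunInP f A → ∀ i → ¬ FunInRule f (rule R i))

-- The translation only changes right-hand sides, and what it adds is of the form
-- ¬[ A ] X, where no rule of R can fire since A is fresh. So every R^A-step out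
-- of a copy of φ with such wrappers is matched by an R-step out of φ, which
-- transfers termination. Since atoms have no proper subformulas, a peak of R^A
-- is either a pair of root steps, i.e. the translation of an R-peak (joined by
-- confluence of R; substitution commutes with the translation because A is
-- closed), or a pair of congruence steps. This is local confluence, and Newman's
-- lemma concludes.
module Submission where

open import Defs
open import Data.Nat using (suc)
open import Data.Fin using (zero; suc)
open import Data.Vec using (Vec; []; _∷_)
open import Data.Product using (_×_; ∃; _,_)
open import Data.Sum using (inj₁)
open import Data.Empty using (⊥-elim)
open import Function using (flip)
open import Relation.Nullary using (¬_)
open import Relation.Binary.Core using (Rel; REL)
open import Relation.Binary.PropositionalEquality using (_≡_; refl; cong; cong₂; subst; sym)
open import Relation.Binary.Construct.Closure.ReflexiveTransitive using (ε; _◅_; gmap)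
open import Relation.Binary.Construct.Closure.Transitive
  using (Plus; [_]; _∼⁺⟨_⟩_; TransClosure; _++_; wellFounded)
open import Relation.Binary.Rewriting using (StronglyNormalizing; WeaklyConfluent; sn&wcr⇒cr)
open import Induction.WellFounded using (Acc; acc; module Subrelation)

module _ {a ℓ} {A : Set a} {_⟶_ : Rel A ℓ} where

  Plus⇒TransClosure-flip : ∀ {x y} → Plus _⟶_ x y → TransClosure (flip _⟶_) y x
  Plus⇒TransClosure-flip [ r ]         = [ r ]
  Plus⇒TransClosure-flip (_ ∼⁺⟨ p ⟩ q) = Plus⇒TransClosure-flip q ++ Plus⇒TransClosure-flip p

  sn⇒sn⁺ : StronglyNormalizing _⟶_ → StronglyNormalizing (Plus _⟶_)
  sn⇒sn⁺ sn = Subrelation.wellFounded Plus⇒TransClosure-flip (wellFounded (flip _⟶_) sn)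

module _ {a b ℓ₁ ℓ₂ ℓ} {A : Set a} {B : Set b} {_⟶₁_ : Rel A ℓ₁} {_⟶₂_ : Rel B ℓ₂}
         {_≼_ : REL A B ℓ}
         (simulate : ∀ {x x′ y′} → x ≼ x′ → x′ ⟶₂ y′ → ∃ λ y → x ⟶₁ y × y ≼ y′) where

  acc-simulated : ∀ {x x′} → Acc (flip _⟶₁_) x → x ≼ x′ → Acc (flip _⟶₂_) x′
  acc-simulated (acc rs) x≼x′ = acc λ s → let (_ , t , y≼y′) = simulate x≼x′ s in
    acc-simulated (rs t) y≼y′

module Properties (S : Signature) where
  open FOL S

  mutual
    substT-renT : ∀ {k m n} (ρ : Ren k m) (σ : Subst m n) (ρ′ : Ren k n) →
      (∀ x → σ (ρ x) ≡ var (ρ′ x)) → ∀ t → substT σ (renT ρ t) ≡ renT ρ′ t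
    substT-renT ρ σ ρ′ h (var x)    = h x
    substT-renT ρ σ ρ′ h (fun f ts) = cong (fun f) (substTs-renTs ρ σ ρ′ h ts)

    substTs-renTs : ∀ {k m n j} (ρ : Ren k m) (σ : Subst m n) (ρ′ : Ren k n) →
      (∀ x → σ (ρ x) ≡ var (ρ′ x)) → (ts : Vec (Term k) j) →
      substTs σ (renTs ρ ts) ≡ renTs ρ′ ts
    substTs-renTs ρ σ ρ′ h []       = refl
    substTs-renTs ρ σ ρ′ h (t ∷ ts) = cong₂ _∷_ (substT-renT ρ σ ρ′ h t) (substTs-renTs ρ σ ρ′ h ts)

  liftS-liftR : ∀ {k m n} (ρ : Ren k m) (σ : Subst m n) (ρ′ : Ren k n) →
    (∀ x → σ (ρ x) ≡ var (ρ′ x)) → ∀ x → liftS σ (liftR ρ x) ≡ var (liftR ρ′ x)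
  liftS-liftR ρ σ ρ′ h zero    = refl
  liftS-liftR ρ σ ρ′ h (suc x) = cong (renT suc) (h x)

  substP-renP : ∀ {k m n} (ρ : Ren k m) (σ : Subst m n) (ρ′ : Ren k n) →
    (∀ x → σ (ρ x) ≡ var (ρ′ x)) → ∀ B → substP σ (renP ρ B) ≡ renP ρ′ B
  substP-renP ρ σ ρ′ h (atom p ts) = cong (atom p) (substTs-renTs ρ σ ρ′ h ts)
  substP-renP ρ σ ρ′ h ⊤′          = refl
  substP-renP ρ σ ρ′ h ⊥′          = refl
  substP-renP ρ σ ρ′ h (B ⇒ C)     = cong₂ _⇒_ (substP-renP ρ σ ρ′ h B) (substP-renP ρ σ ρ′ h C)
  substP-renP ρ σ ρ′ h (B ∧ C)     = cong₂ _∧_ (substP-renP ρ σ ρ′ h B) (substP-renP ρ σ ρ′ h C)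
  substP-renP ρ σ ρ′ h (B ∨ C)     = cong₂ _∨_ (substP-renP ρ σ ρ′ h B) (substP-renP ρ σ ρ′ h C)
  substP-renP ρ σ ρ′ h (∀′ B)      =
    cong ∀′ (substP-renP (liftR ρ) (liftS σ) (liftR ρ′) (liftS-liftR ρ σ ρ′ h) B)
  substP-renP ρ σ ρ′ h (∃′ B)      =
    cong ∃′ (substP-renP (liftR ρ) (liftS σ) (liftR ρ′) (liftS-liftR ρ σ ρ′ h) B)

  substP-weaken₀ : ∀ {m n} (σ : Subst m n) (A : Prop 0) → substP σ (weaken₀ A) ≡ weaken₀ A
  substP-weaken₀ σ A = substP-renP (λ ()) σ (λ ()) (λ ()) A

  substP-¬ : ∀ {m n} (σ : Subst m n) (A : Prop 0) {X : Prop m} {Y : Prop n} →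
    substP σ X ≡ Y → substP σ (¬[ weaken₀ A ] X) ≡ ¬[ weaken₀ A ] Y
  substP-¬ σ A = cong₂ ¬[_]_ (substP-weaken₀ σ A)

  substP-^ : ∀ {m n} (σ : Subst m n) (A : Prop 0) (F : Prop m) →
    substP σ (F ^ A) ≡ substP σ F ^ A
  substP-^ σ A (atom p ts) = refl
  substP-^ σ A ⊤′          = refl
  substP-^ σ A ⊥′          = refl
  substP-^ σ A (B ⇒ C)     = cong₂ _⇒_ (substP-¬ σ A (substP-^ σ A B)) (substP-¬ σ A (substP-^ σ A C))
  substP-^ σ A (B ∧ C)     = cong₂ _∧_ (substP-¬ σ A (substP-^ σ A B)) (substP-¬ σ A (substP-^ σ A C))
  substP-^ σ A (B ∨ C)     = cong₂ _∨_ (substP-¬ σ A (substP-^ σ A B)) (substP-¬ σ A (substP-^ σ A C))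
  substP-^ σ A (∀′ B)      = cong ∀′ (substP-¬ (liftS σ) A (substP-^ (liftS σ) A B))
  substP-^ σ A (∃′ B)      = cong ∃′ (substP-¬ (liftS σ) A (substP-^ (liftS σ) A B))

  PredInP-renP : ∀ {p m n} (ρ : Ren m n) (B : Prop m) → PredInP p (renP ρ B) → PredInP p B
  PredInP-renP ρ (atom p ts) atom   = atom
  PredInP-renP ρ (B ⇒ C)     (⇒l h) = ⇒l (PredInP-renP ρ B h)
  PredInP-renP ρ (B ⇒ C)     (⇒r h) = ⇒r (PredInP-renP ρ C h)
  PredInP-renP ρ (B ∧ C)     (∧l h) = ∧l (PredInP-renP ρ B h)
  PredInP-renP ρ (B ∧ C)     (∧r h) = ∧r (PredInP-renP ρ C h)
  PredInP-renP ρ (B ∨ C)     (∨l h) = ∨l (PredInP-renP ρ B h)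
  PredInP-renP ρ (B ∨ C)     (∨r h) = ∨r (PredInP-renP ρ C h)
  PredInP-renP ρ (∀′ B)      (∀b h) = ∀b (PredInP-renP (liftR ρ) B h)
  PredInP-renP ρ (∃′ B)      (∃b h) = ∃b (PredInP-renP (liftR ρ) B h)

  module Translation (R : RewriteSystem) where

    Inert : ∀ {n} → Prop n → Set
    Inert B = ∀ i → ¬ PredInP (pred (rule R i)) B

    inert-irreducible : ∀ {A : Prop 0} {n} {B B′ : Prop n} → Inert B → ¬ ((R ^ᴿ A) ⊢ B ⟶ B′)
    inert-irreducible c (root i σ) = c i atom
    inert-irreducible c (⇒l s)     = inert-irreducible (λ i h → c i (⇒l h)) s
    inert-irreducible c (⇒r s)     = inert-irreducible (λ i h → c i (⇒r h)) s
    inert-irreducible c (∧l s)     = inert-irreducible (λ i h → c i (∧l h)) s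
    inert-irreducible c (∧r s)     = inert-irreducible (λ i h → c i (∧r h)) s
    inert-irreducible c (∨l s)     = inert-irreducible (λ i h → c i (∨l h)) s
    inert-irreducible c (∨r s)     = inert-irreducible (λ i h → c i (∨r h)) s
    inert-irreducible c (∀b s)     = inert-irreducible (λ i h → c i (∀b h)) s
    inert-irreducible c (∃b s)     = inert-irreducible (λ i h → c i (∃b h)) s

    fresh⇒inert : ∀ {A} → FreshFor R A → Inert A
    fresh⇒inert (pred-fresh , _) i h = pred-fresh _ h i (inj₁ atom)

    data _≼_ : ∀ {n} → Prop n → Prop n → Set where
      atom : ∀ {n} p (ts : Vec (Term n) _) → atom p ts ≼ atom p ts
      ⊤′   : ∀ {n} → ⊤′ {n} ≼ ⊤′
      ⊥′   : ∀ {n} → ⊥′ {n} ≼ ⊥′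
      _⇒_  : ∀ {n} {a a′ b b′ : Prop n} → a ≼ a′ → b ≼ b′ → (a ⇒ b) ≼ (a′ ⇒ b′)
      _∧_  : ∀ {n} {a a′ b b′ : Prop n} → a ≼ a′ → b ≼ b′ → (a ∧ b) ≼ (a′ ∧ b′)
      _∨_  : ∀ {n} {a a′ b b′ : Prop n} → a ≼ a′ → b ≼ b′ → (a ∨ b) ≼ (a′ ∨ b′)
      ∀′   : ∀ {n} {a a′ : Prop (suc n)} → a ≼ a′ → ∀′ a ≼ ∀′ a′
      ∃′   : ∀ {n} {a a′ : Prop (suc n)} → a ≼ a′ → ∃′ a ≼ ∃′ a′
      wrap : ∀ {n} {a a′ B : Prop n} → Inert B → a ≼ a′ → a ≼ (¬[ B ] a′)

    ≼-refl : ∀ {n} (φ : Prop n) → φ ≼ φ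
    ≼-refl (atom p ts) = atom p ts
    ≼-refl ⊤′          = ⊤′
    ≼-refl ⊥′          = ⊥′
    ≼-refl (a ⇒ b)     = ≼-refl a ⇒ ≼-refl b
    ≼-refl (a ∧ b)     = ≼-refl a ∧ ≼-refl b
    ≼-refl (a ∨ b)     = ≼-refl a ∨ ≼-refl b
    ≼-refl (∀′ a)      = ∀′ (≼-refl a)
    ≼-refl (∃′ a)      = ∃′ (≼-refl a)

    module _ (A : Prop 0) (A-inert : Inert A) where

      weaken₀-inert : ∀ {n} → Inert (weaken₀ {n} A)
      weaken₀-inert i h = A-inert i (PredInP-renP (λ ()) A h)

      ≼-^ : ∀ {n} (φ : Prop n) → φ ≼ (φ ^ A)
      ≼-^ (atom p ts) = atom p ts
      ≼-^ ⊤′          = ⊤′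
      ≼-^ ⊥′          = ⊥′
      ≼-^ (a ⇒ b)     = wrap weaken₀-inert (≼-^ a) ⇒ wrap weaken₀-inert (≼-^ b)
      ≼-^ (a ∧ b)     = wrap weaken₀-inert (≼-^ a) ∧ wrap weaken₀-inert (≼-^ b)
      ≼-^ (a ∨ b)     = wrap weaken₀-inert (≼-^ a) ∨ wrap weaken₀-inert (≼-^ b)
      ≼-^ (∀′ a)      = ∀′ (wrap weaken₀-inert (≼-^ a))
      ≼-^ (∃′ a)      = ∃′ (wrap weaken₀-inert (≼-^ a))

      ^ᴿ-simulated : ∀ {n} {φ φ′ ψ′ : Prop n} → φ ≼ φ′ → (R ^ᴿ A) ⊢ φ′ ⟶ ψ′ →
        ∃ λ ψ → R ⊢ φ ⟶ ψ × ψ ≼ ψ′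
      ^ᴿ-simulated (atom p ts) (root i σ) =
        _ , root i σ , subst (_ ≼_) (sym (substP-^ σ A (rhs (rule R i)))) (≼-^ _)
      ^ᴿ-simulated (d ⇒ e) (⇒l s) = let (_ , t , d′) = ^ᴿ-simulated d s in _ , ⇒l t , d′ ⇒ e
      ^ᴿ-simulated (d ⇒ e) (⇒r s) = let (_ , t , e′) = ^ᴿ-simulated e s in _ , ⇒r t , d ⇒ e′
      ^ᴿ-simulated (d ∧ e) (∧l s) = let (_ , t , d′) = ^ᴿ-simulated d s in _ , ∧l t , d′ ∧ e
      ^ᴿ-simulated (d ∧ e) (∧r s) = let (_ , t , e′) = ^ᴿ-simulated e s in _ , ∧r t , d ∧ e′
      ^ᴿ-simulated (d ∨ e) (∨l s) = let (_ , t , d′) = ^ᴿ-simulated d s in _ , ∨l t , d′ ∨ e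
      ^ᴿ-simulated (d ∨ e) (∨r s) = let (_ , t , e′) = ^ᴿ-simulated e s in _ , ∨r t , d ∨ e′
      ^ᴿ-simulated (∀′ d)  (∀b s) = let (_ , t , d′) = ^ᴿ-simulated d s in _ , ∀b t , ∀′ d′
      ^ᴿ-simulated (∃′ d)  (∃b s) = let (_ , t , d′) = ^ᴿ-simulated d s in _ , ∃b t , ∃′ d′
      ^ᴿ-simulated (wrap c d) (⇒l (⇒l s)) =
        let (_ , t , d′) = ^ᴿ-simulated d s in _ , t , wrap c d′
      ^ᴿ-simulated (wrap c d) (⇒l (⇒r s)) = ⊥-elim (inert-irreducible c s)
      ^ᴿ-simulated (wrap c d) (⇒r s)      = ⊥-elim (inert-irreducible c s)

      ^ᴿ-terminating : Terminating R → Terminating (R ^ᴿ A)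
      ^ᴿ-terminating term n φ = acc-simulated ^ᴿ-simulated (term n φ) (≼-refl φ)

      ^-step : ∀ {n} {φ ψ : Prop n} → R ⊢ φ ⟶ ψ → (R ^ᴿ A) ⊢ (φ ^ A) ⟶ (ψ ^ A)
      ^-step (root i σ) = subst ((R ^ᴿ A) ⊢ _ ⟶_) (substP-^ σ A (rhs (rule R i))) (root i σ)
      ^-step (⇒l s)     = ⇒l (⇒l (⇒l (^-step s)))
      ^-step (⇒r s)     = ⇒r (⇒l (⇒l (^-step s)))
      ^-step (∧l s)     = ∧l (⇒l (⇒l (^-step s)))
      ^-step (∧r s)     = ∧r (⇒l (⇒l (^-step s)))
      ^-step (∨l s)     = ∨l (⇒l (⇒l (^-step s)))
      ^-step (∨r s)     = ∨r (⇒l (⇒l (^-step s)))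
      ^-step (∀b s)     = ∀b (⇒l (⇒l (^-step s)))
      ^-step (∃b s)     = ∃b (⇒l (⇒l (^-step s)))

      ^ᴿ-atom-step⁻¹ : ∀ {n p} {ts : Vec (Term n) (Signature.predArity S p)} {ψ} →
        (R ^ᴿ A) ⊢ atom p ts ⟶ ψ →
        ∃ λ ψ₀ → R ⊢ atom p ts ⟶ ψ₀ × ψ ≡ ψ₀ ^ A
      ^ᴿ-atom-step⁻¹ (root i σ) = _ , root i σ , substP-^ σ A (rhs (rule R i))

      ^ᴿ-weaklyConfluent : Confluent R → ∀ {n} → WeaklyConfluent (_⊢_⟶_ (R ^ᴿ A) {n})
      ^ᴿ-weaklyConfluent conf s@(root _ _) t = root-peak (^ᴿ-atom-step⁻¹ s) (^ᴿ-atom-step⁻¹ t)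
        where
        root-peak : ∀ {n} {φ ψ₁ ψ₂ : Prop n} →
          (∃ λ ψ₀ → R ⊢ φ ⟶ ψ₀ × ψ₁ ≡ ψ₀ ^ A) → (∃ λ ψ₀ → R ⊢ φ ⟶ ψ₀ × ψ₂ ≡ ψ₀ ^ A) →
          ∃ λ χ → ((R ^ᴿ A) ⊢ ψ₁ ⟶* χ) × ((R ^ᴿ A) ⊢ ψ₂ ⟶* χ)
        root-peak (_ , s₁ , refl) (_ , s₂ , refl) =
          let (χ , p , q) = conf (s₁ ◅ ε) (s₂ ◅ ε) in χ ^ A , gmap _ ^-step p , gmap _ ^-step q
      ^ᴿ-weaklyConfluent conf (⇒l s) (⇒l t) =
        let (_ , p , q) = ^ᴿ-weaklyConfluent conf s t in _ , gmap _ ⇒l p , gmap _ ⇒l q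
      ^ᴿ-weaklyConfluent conf (⇒l s) (⇒r t) = _ , ⇒r t ◅ ε , ⇒l s ◅ ε
      ^ᴿ-weaklyConfluent conf (⇒r s) (⇒l t) = _ , ⇒l t ◅ ε , ⇒r s ◅ ε
      ^ᴿ-weaklyConfluent conf (⇒r s) (⇒r t) =
        let (_ , p , q) = ^ᴿ-weaklyConfluent conf s t in _ , gmap _ ⇒r p , gmap _ ⇒r q
      ^ᴿ-weaklyConfluent conf (∧l s) (∧l t) =
        let (_ , p , q) = ^ᴿ-weaklyConfluent conf s t in _ , gmap _ ∧l p , gmap _ ∧l q
      ^ᴿ-weaklyConfluent conf (∧l s) (∧r t) = _ , ∧r t ◅ ε , ∧l s ◅ ε
      ^ᴿ-weaklyConfluent conf (∧r s) (∧l t) = _ , ∧l t ◅ ε , ∧r s ◅ ε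
      ^ᴿ-weaklyConfluent conf (∧r s) (∧r t) =
        let (_ , p , q) = ^ᴿ-weaklyConfluent conf s t in _ , gmap _ ∧r p , gmap _ ∧r q
      ^ᴿ-weaklyConfluent conf (∨l s) (∨l t) =
        let (_ , p , q) = ^ᴿ-weaklyConfluent conf s t in _ , gmap _ ∨l p , gmap _ ∨l q
      ^ᴿ-weaklyConfluent conf (∨l s) (∨r t) = _ , ∨r t ◅ ε , ∨l s ◅ ε
      ^ᴿ-weaklyConfluent conf (∨r s) (∨l t) = _ , ∨l t ◅ ε , ∨r s ◅ ε
      ^ᴿ-weaklyConfluent conf (∨r s) (∨r t) =
        let (_ , p , q) = ^ᴿ-weaklyConfluent conf s t in _ , gmap _ ∨r p , gmap _ ∨r q
      ^ᴿ-weaklyConfluent conf (∀b s) (∀b t) =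
        let (_ , p , q) = ^ᴿ-weaklyConfluent conf s t in _ , gmap _ ∀b p , gmap _ ∀b q
      ^ᴿ-weaklyConfluent conf (∃b s) (∃b t) =
        let (_ , p , q) = ^ᴿ-weaklyConfluent conf s t in _ , gmap _ ∃b p , gmap _ ∃b q

      ^ᴿ-confluent : Terminating R → Confluent R → Confluent (R ^ᴿ A)
      ^ᴿ-confluent term conf {n} =
        sn&wcr⇒cr {_⟶_ = _⊢_⟶_ (R ^ᴿ A)} (sn⇒sn⁺ (^ᴿ-terminating term n)) (^ᴿ-weaklyConfluent conf)

proposition8 : (S : Signature) → let open FOL S in
    (R : RewriteSystem) → IsPropRewriteSystem R →
    (A : Prop 0) → FreshFor R A →
    Terminating R → Confluent R →
    Terminating (R ^ᴿ A) × Confluent (R ^ᴿ A)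
proposition8 S R _ A fresh term conf =
  ^ᴿ-terminating A (fresh⇒inert fresh) term , ^ᴿ-confluent A (fresh⇒inert fresh) term conf
  where
  open Properties S
  open Translation R
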